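{- Let $a,b$ be integers with $2\leq a<b$. Then $$I_{a,b}\leq a^{a+b-2}.$$
   Context: $K_{a,b}$ denotes the complete bipartite graph with partite sets of sizes $a$ and $b$. $I_{a,b}$ denotes the number of isomorphism classes (under graph isomorphism) of spanning trees of $K_{a,b}$. -}

module Defs where

open import Data.Nat using (ℕ; _∸_; _+_; _^_; _≤_)
open import Data.Fin using (Fin)
open import Data.Bool using (Bool; true)
open import Data.Sum using (_⊎_; inj₁; inj₂)
open import Data.Empty using (⊥)
open import Data.Product using (Σ; _×_)
open import Data.List using (List; _∷_; _∷ʳ_)
open import Data.List.Relation.Unary.Linked using (Linked)
open import Data.List.Relation.Unary.Unique.Propositional using (Unique)
open import Relation.Binary.Construct.Closure.ReflexiveTransitive using (Star)
open import Relation.Binary.PropositionalEquality using (_≡_)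
open import Relation.Nullary using (¬_)
open import Function.Bundles using (_↔_; _⇔_; Inverse)

module _ {V : Set} (Adj : V → V → Set) where

  Connected : Set
  Connected = ∀ u v → Star Adj u v

  HasCycle : Set
  HasCycle = Σ V λ x → Σ V λ y → Σ V λ z → Σ (List V) λ vs →
    Unique (x ∷ y ∷ z ∷ vs) × Linked Adj ((x ∷ y ∷ z ∷ vs) ∷ʳ x)

  Acyclic : Set
  Acyclic = ¬ HasCycle

  IsTree : Set
  IsTree = Connected × Acyclic

KVertex : ℕ → ℕ → Set
KVertex a b = Fin a ⊎ Fin b

-- a spanning subgraph of K_{a,b} is a subset of its edge set,
-- given as a Boolean edge indicator E i j for the edge {inj₁ i, inj₂ j}
EdgeSet : ℕ → ℕ → Set
EdgeSet a b = Fin a → Fin b → Bool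

SAdj : ∀ {a b} → EdgeSet a b → KVertex a b → KVertex a b → Set
SAdj E (inj₁ i) (inj₂ j) = E i j ≡ true
SAdj E (inj₂ j) (inj₁ i) = E i j ≡ true
SAdj E (inj₁ _) (inj₁ _) = ⊥
SAdj E (inj₂ _) (inj₂ _) = ⊥

SpanningTree : ℕ → ℕ → Set
SpanningTree a b = Σ (EdgeSet a b) λ E → IsTree (SAdj E)

-- graph isomorphism between two spanning trees (as abstract graphs:
-- any bijection of the vertex set preserving and reflecting adjacency)
Isomorphic : ∀ {a b} → SpanningTree a b → SpanningTree a b → Set
Isomorphic {a} {b} (E Data.Product., _) (E' Data.Product., _) =
  Σ (KVertex a b ↔ KVertex a b) λ σ →
    ∀ u v → SAdj E u v ⇔ SAdj E' (Inverse.to σ u) (Inverse.to σ v)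

-- "I_{a,b} ≤ N": every family of pairwise non-isomorphic spanning trees
-- of K_{a,b} has at most N members (i.e. there are at most N
-- isomorphism classes of spanning trees of K_{a,b}).
IsoClassesAtMost : ℕ → ℕ → ℕ → Set
IsoClassesAtMost a b N =
  ∀ n (T : Fin n → SpanningTree a b) →
    (∀ i j → Isomorphic (T i) (T j) → i ≡ j) → n ≤ N

{-# OPTIONS --safe #-}
-- Root a spanning tree of K_{a,b} at the first vertex of the a-side. Then it is determined by
-- the parent map of the b-side (values among a vertices) and the parent map of the a - 1
-- non-root vertices of the a-side (values in the b-side). Relabelling the b-side, we may
-- assume the parent of the t-th non-root vertex (t = 0, 1, …) has label at most t (this needs
-- a - 1 ≤ b): the first of these parents is then forced, and the other a - 2 have fewer than a
-- possible labels. So a relabelled tree is described by a word of length (a - 2) + b over an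
-- alphabet of size a, and trees with the same word are isomorphic through the relabellings of
-- the b-side.
module Submission where

open import Data.Empty using (⊥; ⊥-elim)
open import Data.Bool using (true)
open import Data.Fin using (Fin; zero; suc; toℕ; fromℕ; fromℕ<; inject₁; splitAt; _↑ˡ_; _↑ʳ_; funToFin; finToFun)
open import Data.Fin.Permutation using (Permutation′; _⟨$⟩ʳ_; _⟨$⟩ˡ_; _∘ₚ_; flip; id; transpose; inverseˡ)
import Data.Fin.Permutation.Components as PC
open import Data.Fin.Properties
  using (_≟_; toℕ-injective; toℕ<n; toℕ-fromℕ; toℕ-fromℕ<; toℕ-inject₁; fromℕ<-injective; splitAt-↑ˡ; splitAt-↑ʳ; finToFun-funToFin; injective⇒≤)
open import Data.List using (List; []; _∷_; _∷ʳ_)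
open import Data.List.Membership.Propositional using (_∈_; _∉_)
open import Data.List.Relation.Binary.Subset.Propositional using (_⊆_)
open import Data.List.Relation.Binary.Subset.Propositional.Properties using (⊆-refl; ⊆-trans; xs⊆x∷xs; ∷⁺ʳ)
open import Data.List.Relation.Unary.All using ([])
open import Data.List.Relation.Unary.All.Properties using (¬Any⇒All¬)
open import Data.List.Relation.Unary.AllPairs using ([]; _∷_)
open import Data.List.Relation.Unary.Any using (here; there)
open import Data.List.Relation.Unary.Linked using (Linked; [-]; _∷_)
open import Data.List.Relation.Unary.Unique.Propositional using (Unique)
open import Data.List.Relation.Unary.Unique.Propositional.Properties using (Unique[x∷xs]⇒x∉xs)
open import Data.Nat using (ℕ; zero; suc; _≤_; _<_; _+_; _∸_; _^_; z≤n; s≤s; _≤?_)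
open import Data.Nat.Properties
  using (≤-trans; ≤-reflexive; <⇒≤; <-irrefl; ≤-<-trans; m<n⇒m<1+n; n≤0⇒n≡0; m+n≤o⇒n≤o; module ≤-Reasoning)
open import Data.Product using (Σ; _×_; _,_; proj₁; proj₂)
open import Data.Sum using (_⊎_; inj₁; inj₂; [_,_]′; map₁)
open import Data.Sum.Function.Propositional using (_⊎-↔_)
open import Data.Sum.Properties using (≡-dec; inj₁-injective; inj₂-injective)
open import Function using (_∘_)
open import Function.Bundles using (_↔_; _⇔_; mk⇔; Inverse; Injection)
open import Function.Construct.Composition using (_⇔-∘_)
open import Function.Construct.Identity using (↔-id; ⇔-id)
open import Function.Properties.Equivalence using () renaming (sym to ⇔-sym)
open import Function.Properties.Inverse using (↔⇒↣)
open import Level using (0ℓ)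
open import Relation.Binary using (Rel; Symmetric; DecidableEquality)
open import Relation.Binary.Construct.Closure.ReflexiveTransitive using (Star; ε; _◅_; _◅◅_; revApp; reverse)
open import Relation.Binary.PropositionalEquality using (_≡_; _≢_; _≗_; refl; sym; trans; cong; subst; module ≡-Reasoning)
open import Relation.Nullary using (¬_; yes; no)
import Data.List.Membership.DecPropositional as DecMembership

open import Defs

module Walk {V : Set} {Adj : Rel V 0ℓ} where

  vertices     : ∀ {x y} → Star Adj x y → List V
  tailVertices : ∀ {x y} → Star Adj x y → List V

  vertices {x} w = x ∷ tailVertices w

  tailVertices ε       = []
  tailVertices (_ ◅ w) = vertices w

  next : ∀ {x y} → Star Adj x y → V
  next {x} ε             = x
  next (_◅_ {j = z} _ _) = z

  next-adjacent : ∀ {x y} (w : Star Adj x y) → x ≢ y → Adj x (next w)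
  next-adjacent ε       x≢x = ⊥-elim (x≢x refl)
  next-adjacent (e ◅ _) _   = e

  end∈vertices : ∀ {x y} (w : Star Adj x y) → y ∈ vertices w
  end∈vertices ε       = here refl
  end∈vertices (_ ◅ w) = there (end∈vertices w)

  prefix : ∀ {x y z} (w : Star Adj x y) → z ∈ vertices w →
           Σ (Star Adj x z) λ p → vertices p ⊆ vertices w
  prefix w       (here refl) = ε , λ { (here refl) → here refl }
  prefix (e ◅ w) (there z∈w) with prefix w z∈w
  ... | p , p⊆w = e ◅ p , ∷⁺ʳ _ p⊆w

  suffix : ∀ {x y z} (w : Star Adj x y) → z ∈ vertices w →
           Σ (Star Adj z y) λ s → vertices s ⊆ vertices w × (Unique (vertices w) → Unique (vertices s))
  suffix w       (here refl) = w , ⊆-refl , λ u → u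
  suffix (e ◅ w) (there z∈w) with suffix w z∈w
  ... | s , s⊆w , unique = s , ⊆-trans s⊆w (xs⊆x∷xs _ _) , λ { (_ ∷ u) → unique u }

  ∈-◅◅ : ∀ {x y z v} (w : Star Adj x y) (w′ : Star Adj y z) →
         v ∈ vertices (w ◅◅ w′) → v ∈ vertices w ⊎ v ∈ vertices w′
  ∈-◅◅ ε       w′ v∈ = inj₂ v∈
  ∈-◅◅ (_ ◅ w) w′ (here v≡x) = inj₁ (here v≡x)
  ∈-◅◅ (_ ◅ w) w′ (there v∈) = map₁ there (∈-◅◅ w w′ v∈)

  ∈-revApp : (symmetric : Symmetric Adj) → ∀ {x y z v} (w : Star Adj x y) (acc : Star Adj x z) →
             v ∈ vertices (revApp symmetric w acc) → v ∈ vertices w ⊎ v ∈ vertices acc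
  ∈-revApp symmetric ε       acc v∈ = inj₂ v∈
  ∈-revApp symmetric (e ◅ w) acc v∈ with ∈-revApp symmetric w (symmetric e ◅ acc) v∈
  ... | inj₁ v∈w         = inj₁ (there v∈w)
  ... | inj₂ (here refl) = inj₁ (there (here refl))
  ... | inj₂ (there v∈)  = inj₂ v∈

  ∈-reverse : (symmetric : Symmetric Adj) → ∀ {x y v} (w : Star Adj x y) →
              v ∈ vertices (reverse symmetric w) → v ∈ vertices w
  ∈-reverse symmetric w v∈ with ∈-revApp symmetric w ε v∈
  ... | inj₁ v∈w         = v∈w
  ... | inj₂ (here refl) = here refl

  snoc-linked : ∀ {x y c} (w : Star Adj x y) → Adj y c → Linked Adj (vertices w ∷ʳ c)
  snoc-linked ε       yc = yc ∷ [-]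
  snoc-linked (e ◅ w) yc = e ∷ snoc-linked w yc


module SimpleGraph {V : Set} {Adj : Rel V 0ℓ} (_≟V_ : DecidableEquality V)
                   (symmetric : Symmetric Adj) (irreflexive : ∀ {x} → ¬ Adj x x) where

  open Walk {Adj = Adj}
  open DecMembership _≟V_ using (_∈?_)

  simplify : ∀ {x y} (w : Star Adj x y) →
             Σ (Star Adj x y) λ s → Unique (vertices s) × vertices s ⊆ vertices w
  simplify ε = ε , [] ∷ [] , ⊆-refl
  simplify {x} (e ◅ w) with simplify w
  ... | s , unique , s⊆w with x ∈? vertices s
  ...   | no x∉s  = e ◅ s , ¬Any⇒All¬ _ x∉s ∷ unique , ∷⁺ʳ x s⊆w
  ...   | yes x∈s = let s′ , s′⊆s , unique′ = suffix s x∈s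
                    in s′ , unique′ unique , ⊆-trans s′⊆s (⊆-trans s⊆w (xs⊆x∷xs _ x))

  module Forest (acyclic : Acyclic Adj) where

    -- The walk, made simple, closes up with c into a cycle.
    ¬bypass : ∀ {c x y} → Adj c x → Adj c y → x ≢ y → (w : Star Adj x y) → c ∉ vertices w → ⊥
    ¬bypass cx cy x≢y w c∉w with simplify w
    ... | ε     , _      , _   = x≢y refl
    ... | e ◅ s , unique , s⊆w =
      acyclic (_ , _ , _ , tailVertices s , ¬Any⇒All¬ _ (c∉w ∘ s⊆w) ∷ unique , cx ∷ snoc-linked (e ◅ s) (symmetric cy))

    neighbour-on-simpleWalk⇒next : ∀ {u x y} → Adj u x → (w : Star Adj x y) → Unique (vertices w) →
                                   u ∈ vertices w → next w ≡ u
    neighbour-on-simpleWalk⇒next ux w _ (here refl) = ⊥-elim (irreflexive ux)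
    neighbour-on-simpleWalk⇒next {u} ux (_◅_ {j = z} e w) unique (there u∈w) with z ≟V u
    ... | yes z≡u = z≡u
    ... | no z≢u  = let p , p⊆w = prefix w u∈w
                    in ⊥-elim (¬bypass e (symmetric ux) z≢u p (Unique[x∷xs]⇒x∉xs unique ∘ p⊆w))

    neighbour-off-walk⇒next : ∀ {u v y} → Adj u v → (w : Star Adj v y) → u ∉ vertices w →
                              (s : Star Adj u y) → Unique (vertices s) → next s ≡ v
    neighbour-off-walk⇒next uv w u∉w ε _ = ⊥-elim (u∉w (end∈vertices w))
    neighbour-off-walk⇒next {v = v} uv w u∉w (_◅_ {j = z} e s) unique with z ≟V v
    ... | yes z≡v = z≡v
    ... | no z≢v  = ⊥-elim (¬bypass uv e (z≢v ∘ sym) (w ◅◅ reverse symmetric s) u∉detour)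
      where
        u∉detour : _ ∉ vertices (w ◅◅ reverse symmetric s)
        u∉detour = [ u∉w , Unique[x∷xs]⇒x∉xs unique ∘ ∈-reverse symmetric s ]′ ∘ ∈-◅◅ w (reverse symmetric s)

  module RootedTree (tree : IsTree Adj) (root : V) where

    open Forest (proj₂ tree)

    pathToRoot : ∀ x → Star Adj x root
    pathToRoot x = proj₁ (simplify (proj₁ tree x root))

    pathToRoot-unique : ∀ x → Unique (vertices (pathToRoot x))
    pathToRoot-unique x = proj₁ (proj₂ (simplify (proj₁ tree x root)))

    parent : V → V
    parent x = next (pathToRoot x)

    parent-adjacent : ∀ {x} → x ≢ root → Adj x (parent x)
    parent-adjacent {x} = next-adjacent (pathToRoot x)

    adjacent⇒parent : ∀ {u v} → Adj u v → parent v ≡ u ⊎ (u ≢ root × parent u ≡ v)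
    adjacent⇒parent {u} {v} uv with u ∈? vertices (pathToRoot v)
    ... | yes u∈ = inj₁ (neighbour-on-simpleWalk⇒next uv (pathToRoot v) (pathToRoot-unique v) u∈)
    ... | no u∉  = inj₂ (u≢root , neighbour-off-walk⇒next uv (pathToRoot v) u∉ (pathToRoot u) (pathToRoot-unique u))
      where
        u≢root : u ≢ root
        u≢root refl = u∉ (end∈vertices (pathToRoot v))


transpose-source : ∀ {n} (i j : Fin n) → PC.transpose i j i ≡ j
transpose-source i j with i ≟ i
... | yes _  = refl
... | no i≢i = ⊥-elim (i≢i refl)

transpose-fixes : ∀ {n} {i j k : Fin n} → k ≢ i → k ≢ j → PC.transpose i j k ≡ k
transpose-fixes {i = i} {j} {k} k≢i k≢j with k ≟ i
... | yes k≡i = ⊥-elim (k≢i k≡i)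
... | no _ with k ≟ j
...   | yes k≡j = ⊥-elim (k≢j k≡j)
...   | no _    = refl

lower-≤ : ∀ {n k} (π : Permutation′ n) (x : Fin n) → k < n →
          Σ (Permutation′ n) λ π′ →
            toℕ (π′ ⟨$⟩ʳ x) ≤ k × (∀ y → toℕ (π ⟨$⟩ʳ y) < k → π′ ⟨$⟩ʳ y ≡ π ⟨$⟩ʳ y)
lower-≤ {k = k} π x k<n with toℕ (π ⟨$⟩ʳ x) ≤? k
... | yes πx≤k = π , πx≤k , λ _ _ → refl
... | no πx≰k  = π ∘ₚ transpose (π ⟨$⟩ʳ x) κ , ≤-reflexive πx↦k , fixes
  where
    κ : Fin _
    κ = fromℕ< k<n

    πx↦k : toℕ (PC.transpose (π ⟨$⟩ʳ x) κ (π ⟨$⟩ʳ x)) ≡ k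
    πx↦k = trans (cong toℕ (transpose-source (π ⟨$⟩ʳ x) κ)) (toℕ-fromℕ< k<n)

    fixes : ∀ y → toℕ (π ⟨$⟩ʳ y) < k → PC.transpose (π ⟨$⟩ʳ x) κ (π ⟨$⟩ʳ y) ≡ π ⟨$⟩ʳ y
    fixes y πy<k = transpose-fixes πy≢πx πy≢κ
      where
        πy≢πx : π ⟨$⟩ʳ y ≢ π ⟨$⟩ʳ x
        πy≢πx πy≡πx = πx≰k (<⇒≤ (subst (λ z → toℕ z < k) πy≡πx πy<k))
        πy≢κ : π ⟨$⟩ʳ y ≢ κ
        πy≢κ πy≡κ = <-irrefl (trans (cong toℕ πy≡κ) (toℕ-fromℕ< k<n)) πy<k

data LastOrInject₁ : ∀ {m} → Fin (suc m) → Set where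
  last    : ∀ {m} → LastOrInject₁ (fromℕ m)
  earlier : ∀ {m} (t : Fin m) → LastOrInject₁ (inject₁ t)

lastOrInject₁ : ∀ {m} (t : Fin (suc m)) → LastOrInject₁ t
lastOrInject₁ {zero}  zero    = last
lastOrInject₁ {suc m} zero    = earlier zero
lastOrInject₁ {suc m} (suc t) with lastOrInject₁ t
... | last       = last
... | earlier t′ = earlier (suc t′)

relabel-≤-index : ∀ {m n} (h : Fin m → Fin n) → m ≤ n →
                  Σ (Permutation′ n) λ π → ∀ t → toℕ (π ⟨$⟩ʳ h t) ≤ toℕ t
relabel-≤-index {zero}  h _   = id , λ ()
relabel-≤-index {suc m} h m<n with relabel-≤-index (h ∘ inject₁) (<⇒≤ m<n)
... | π , π≤ with lower-≤ π (h (fromℕ m)) m<n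
... | π′ , π′≤m , agrees = π′ , π′≤
  where
    π′≤ : ∀ t → toℕ (π′ ⟨$⟩ʳ h t) ≤ toℕ t
    π′≤ t with lastOrInject₁ t
    ... | last       = ≤-trans π′≤m (≤-reflexive (sym (toℕ-fromℕ m)))
    ... | earlier t′ = begin
      toℕ (π′ ⟨$⟩ʳ h (inject₁ t′)) ≡⟨ cong toℕ (agrees _ (≤-<-trans (π≤ t′) (toℕ<n t′))) ⟩
      toℕ (π ⟨$⟩ʳ h (inject₁ t′))  ≤⟨ π≤ t′ ⟩
      toℕ t′                       ≡⟨ toℕ-inject₁ t′ ⟨
      toℕ (inject₁ t′)             ∎
      where open ≤-Reasoning


module _ {a b : ℕ} (E : EdgeSet a b) where

  SAdj-sym : Symmetric (SAdj E)
  SAdj-sym {inj₁ _} {inj₂ _} e = e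
  SAdj-sym {inj₂ _} {inj₁ _} e = e
  SAdj-sym {inj₁ _} {inj₁ _} ()
  SAdj-sym {inj₂ _} {inj₂ _} ()

  SAdj-irrefl : ∀ {x} → ¬ SAdj E x x
  SAdj-irrefl {inj₁ _} ()
  SAdj-irrefl {inj₂ _} ()

-- The root is inj₁ zero; up j is the parent of the vertex inj₂ j and down t that of inj₁ (suc t).
ParentEdge : ∀ {a b} → (Fin b → Fin (suc a)) → (Fin a → Fin b) → Fin (suc a) → Fin b → Set
ParentEdge up down i j = up j ≡ i ⊎ Σ (Fin _) λ t → i ≡ suc t × down t ≡ j

record ParentMaps {a b : ℕ} (E : EdgeSet (suc a) b) : Set where
  field
    up    : Fin b → Fin (suc a)
    down  : Fin a → Fin b
    edge⇔ : ∀ {i j} → E i j ≡ true ⇔ ParentEdge up down i j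

open ParentMaps

parentMaps : ∀ {a b} (T : SpanningTree (suc a) b) → ParentMaps (proj₁ T)
parentMaps {a} {b} (E , tree) = record { up = up′ ; down = down′ ; edge⇔ = mk⇔ to from }
  where
    open SimpleGraph {Adj = SAdj E} (≡-dec _≟_ _≟_) (SAdj-sym E) (SAdj-irrefl E)
    open RootedTree tree (inj₁ zero)

    parentOf-inj₂ : ∀ j → Σ (Fin (suc a)) λ i → parent (inj₂ j) ≡ inj₁ i × E i j ≡ true
    parentOf-inj₂ j with parent (inj₂ j) | parent-adjacent {inj₂ j} (λ ())
    ... | inj₁ i | e = i , refl , e

    parentOf-inj₁ : ∀ t → Σ (Fin b) λ j → parent (inj₁ (suc t)) ≡ inj₂ j × E (suc t) j ≡ true
    parentOf-inj₁ t with parent (inj₁ (suc t)) | parent-adjacent {inj₁ (suc t)} (λ ())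
    ... | inj₂ j | e = j , refl , e

    up′ : Fin b → Fin (suc a)
    up′ j = proj₁ (parentOf-inj₂ j)

    down′ : Fin a → Fin b
    down′ t = proj₁ (parentOf-inj₁ t)

    to : ∀ {i j} → E i j ≡ true → ParentEdge up′ down′ i j
    to {i} {j} eij with adjacent⇒parent {inj₁ i} {inj₂ j} eij
    ... | inj₁ parent≡i = inj₁ (inj₁-injective (trans (sym (proj₁ (proj₂ (parentOf-inj₂ j)))) parent≡i))
    to {zero}  eij | inj₂ (i≢root , _) = ⊥-elim (i≢root refl)
    to {suc t} {j} eij | inj₂ (_ , parent≡j) =
      inj₂ (t , refl , inj₂-injective (trans (sym (proj₁ (proj₂ (parentOf-inj₁ t)))) parent≡j))

    from : ∀ {i j} → ParentEdge up′ down′ i j → E i j ≡ true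
    from {j = j} (inj₁ refl)            = proj₂ (proj₂ (parentOf-inj₂ j))
    from         (inj₂ (t , refl , refl)) = proj₂ (proj₂ (parentOf-inj₁ t))

parentEdge-relabel : ∀ {a b} {up up′ : Fin b → Fin (suc a)} {down down′ : Fin a → Fin b}
                     (ρ : Permutation′ b) → (∀ j → up′ (ρ ⟨$⟩ʳ j) ≡ up j) → (∀ t → down′ t ≡ ρ ⟨$⟩ʳ down t) →
                     ∀ {i j} → ParentEdge up down i j ⇔ ParentEdge up′ down′ i (ρ ⟨$⟩ʳ j)
parentEdge-relabel {up = up} {up′} {down} {down′} ρ up≡ down≡ {i} {j} = mk⇔ to from
  where
    to : ParentEdge up down i j → ParentEdge up′ down′ i (ρ ⟨$⟩ʳ j)
    to (inj₁ up≡i)               = inj₁ (trans (up≡ j) up≡i)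
    to (inj₂ (t , i≡t+1 , down≡j)) = inj₂ (t , i≡t+1 , trans (down≡ t) (cong (ρ ⟨$⟩ʳ_) down≡j))

    from : ParentEdge up′ down′ i (ρ ⟨$⟩ʳ j) → ParentEdge up down i j
    from (inj₁ up′≡i)               = inj₁ (trans (sym (up≡ j)) up′≡i)
    from (inj₂ (t , i≡t+1 , down′≡ρj)) =
      inj₂ (t , i≡t+1 , Injection.injective (↔⇒↣ ρ) (trans (sym (down≡ t)) down′≡ρj))

relabelled⇒isomorphic : ∀ {a b} (T T′ : SpanningTree (suc a) b) (P : ParentMaps (proj₁ T)) (P′ : ParentMaps (proj₁ T′))
                        (ρ : Permutation′ b) → (∀ j → up P′ (ρ ⟨$⟩ʳ j) ≡ up P j) → (∀ t → down P′ t ≡ ρ ⟨$⟩ʳ down P t) →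
                        Isomorphic T T′
relabelled⇒isomorphic {a} {b} (E , _) (E′ , _) P P′ ρ up≡ down≡ = σ , adjacency
  where
    σ : KVertex (suc a) b ↔ KVertex (suc a) b
    σ = ↔-id (Fin (suc a)) ⊎-↔ ρ

    edge : ∀ {i j} → E i j ≡ true ⇔ E′ i (ρ ⟨$⟩ʳ j) ≡ true
    edge = ⇔-sym (edge⇔ P′) ⇔-∘ (parentEdge-relabel {up′ = up P′} {down′ = down P′} ρ up≡ down≡ ⇔-∘ edge⇔ P)

    adjacency : ∀ u v → SAdj E u v ⇔ SAdj E′ (Inverse.to σ u) (Inverse.to σ v)
    adjacency (inj₁ _) (inj₂ _) = edge
    adjacency (inj₂ _) (inj₁ _) = edge
    adjacency (inj₁ _) (inj₁ _) = ⇔-id ⊥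
    adjacency (inj₂ _) (inj₂ _) = ⇔-id ⊥


module Coding {a b : ℕ} (a<b : a < b) {E : EdgeSet (2 + a) b} (P : ParentMaps E) where

  labelling : Permutation′ b
  labelling = proj₁ (relabel-≤-index (down P) a<b)

  labelling-≤ : ∀ t → toℕ (labelling ⟨$⟩ʳ down P t) ≤ toℕ t
  labelling-≤ = proj₂ (relabel-≤-index (down P) a<b)

  labelling-down<2+a : ∀ t → toℕ (labelling ⟨$⟩ʳ down P (suc t)) < 2 + a
  labelling-down<2+a t = m<n⇒m<1+n (≤-<-trans (labelling-≤ (suc t)) (toℕ<n (suc t)))

  downCode : Fin a → Fin (2 + a)
  downCode t = fromℕ< (labelling-down<2+a t)

  upCode : Fin b → Fin (2 + a)
  upCode j = up P (labelling ⟨$⟩ˡ j)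

  code : Fin (a + b) → Fin (2 + a)
  code = [ downCode , upCode ]′ ∘ splitAt a

  code-↑ˡ : ∀ t → code (t ↑ˡ b) ≡ downCode t
  code-↑ˡ t = cong [ downCode , upCode ]′ (splitAt-↑ˡ a t b)

  code-↑ʳ : ∀ j → code (a ↑ʳ j) ≡ upCode j
  code-↑ʳ j = cong [ downCode , upCode ]′ (splitAt-↑ʳ a b j)

open Coding using (labelling; labelling-≤; downCode; code; code-↑ˡ; code-↑ʳ)

sameCode⇒isomorphic : ∀ {a b} (a<b : a < b) (T T′ : SpanningTree (2 + a) b) →
                      code a<b (parentMaps T) ≗ code a<b (parentMaps T′) → Isomorphic T T′
sameCode⇒isomorphic {a} {b} a<b T T′ sameCode = relabelled⇒isomorphic T T′ P P′ (π ∘ₚ flip π′) up≡ down≡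
  where
    open ≡-Reasoning

    P : ParentMaps (proj₁ T)
    P = parentMaps T

    P′ : ParentMaps (proj₁ T′)
    P′ = parentMaps T′

    π π′ : Permutation′ b
    π  = labelling a<b P
    π′ = labelling a<b P′

    sameUp : ∀ j → up P (π ⟨$⟩ˡ j) ≡ up P′ (π′ ⟨$⟩ˡ j)
    sameUp j = begin
      up P (π ⟨$⟩ˡ j)      ≡⟨ code-↑ʳ a<b P j ⟨
      code a<b P (a ↑ʳ j)  ≡⟨ sameCode (a ↑ʳ j) ⟩
      code a<b P′ (a ↑ʳ j) ≡⟨ code-↑ʳ a<b P′ j ⟩
      up P′ (π′ ⟨$⟩ˡ j)    ∎

    sameDown : ∀ t → π ⟨$⟩ʳ down P t ≡ π′ ⟨$⟩ʳ down P′ t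
    sameDown zero    = toℕ-injective (trans (n≤0⇒n≡0 (labelling-≤ a<b P zero))
                                            (sym (n≤0⇒n≡0 (labelling-≤ a<b P′ zero))))
    sameDown (suc t) = toℕ-injective (fromℕ<-injective _ _ _ _ (begin
      downCode a<b P t     ≡⟨ code-↑ˡ a<b P t ⟨
      code a<b P (t ↑ˡ b)  ≡⟨ sameCode (t ↑ˡ b) ⟩
      code a<b P′ (t ↑ˡ b) ≡⟨ code-↑ˡ a<b P′ t ⟩
      downCode a<b P′ t    ∎))

    up≡ : ∀ j → up P′ (π′ ⟨$⟩ˡ (π ⟨$⟩ʳ j)) ≡ up P j
    up≡ j = trans (sym (sameUp (π ⟨$⟩ʳ j))) (cong (up P) (inverseˡ π))

    down≡ : ∀ t → down P′ t ≡ π′ ⟨$⟩ˡ (π ⟨$⟩ʳ down P t)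
    down≡ t = trans (sym (inverseˡ π′)) (cong (π′ ⟨$⟩ˡ_) (sym (sameDown t)))

funToFin-injective : ∀ {m n} {f g : Fin m → Fin n} → funToFin f ≡ funToFin g → f ≗ g
funToFin-injective {m} {n} {f} {g} f≡g i = begin
  f i                     ≡⟨ finToFun-funToFin f i ⟨
  finToFun (funToFin f) i ≡⟨ cong (λ c → finToFun {n} {m} c i) f≡g ⟩
  finToFun (funToFin g) i ≡⟨ finToFun-funToFin g i ⟩
  g i                     ∎
  where open ≡-Reasoning

completeInvariant⇒isoClassesAtMost : ∀ {a b N} (c : SpanningTree a b → Fin N) →
                                     (∀ T T′ → c T ≡ c T′ → Isomorphic T T′) → IsoClassesAtMost a b N
completeInvariant⇒isoClassesAtMost c complete n T distinct =
  injective⇒≤ λ {i} {j} cTi≡cTj → distinct i j (complete (T i) (T j) cTi≡cTj)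

isoClassesAtMost : ∀ {a b} → a < b → IsoClassesAtMost (2 + a) b ((2 + a) ^ (a + b))
isoClassesAtMost a<b = completeInvariant⇒isoClassesAtMost
  (λ T → funToFin (code a<b (parentMaps T)))
  (λ T T′ same → sameCode⇒isomorphic a<b T T′ (funToFin-injective same))

theorem2p6 : ∀ (a b : ℕ) → 2 ≤ a → a < b → IsoClassesAtMost a b (a ^ (a + b ∸ 2))
theorem2p6 (suc (suc a)) b (s≤s (s≤s z≤n)) 2+a<b = isoClassesAtMost (m+n≤o⇒n≤o 2 2+a<b)
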